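{- Let $\pi$ be a $321$-avoiding permutation and let $\pi^\sharp$ be a staircase gridding of $\pi$. Then $\pi^\sharp$ is greedy if and only if it satisfies the following two conditions: (G1) for all $i\ge 1$, if the $(i+1)$st cell is nonempty, its first entry occurs before all entries of the $(i+2)$nd cell; (G2) for all $i\ge 1$, if the $(i+1)$st cell is nonempty, its first entry is followed (not necessarily immediately) by an entry of the $i$th cell. Here "first" and "before/followed" refer to the following order on the entries of two consecutive cells $j$ and $j+1$: if $j$ is odd (so cell $j+1$ lies to the right of cell $j$), entries are ordered from bottom to top (by value); if $j$ is even (so cell $j+1$ lies above cell $j$), entries are ordered from left to right (by position). (Within a single cell, both orders coincide since its entries are increasing.)
   Context: A staircase gridding of a $321$-avoiding permutation $\pi$ is a partition of its entries into cells labelled by the positive integers such that: the entries in each cell form an increasing sequence; for $i\ge 1$, all entries in cell $2i$ lie to the right of those in cell $2i-1$; for $i\ge1$, all entries in cell $2i+1$ lie above those in cell $2i$; and if $j\ge i+2$ then all entries in cell $j$ lie above and to the right of all entries in cell $i$. A staircase gridding is greedy if the first cell contains as many entries as possible, subject to this the second cell contains as many entries as possible, and so on. -}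

module Defs where

open import Data.Nat using (ℕ; zero; suc; _+_; _*_; _≤_; _<_)
open import Data.Nat.Properties using (_≟_)
open import Data.Fin using (Fin; toℕ)
open import Data.Fin.Permutation using (Permutation′; _⟨$⟩ʳ_)
open import Data.List using (length; filter; allFin)
open import Data.Bool using (Bool; true; false; if_then_else_)
open import Data.Product using (_×_; ∃)
open import Relation.Binary.PropositionalEquality using (_≡_)
open import Relation.Nullary using (¬_)

-- Entries of a permutation π of length n are indexed by their positions a : Fin n;
-- the entry at position a has value π ⟨$⟩ʳ a.  "x left of y" = position a < position b,
-- "x below y" = value of a < value of b.

val : ∀ {n} → Permutation′ n → Fin n → ℕ
val π a = toℕ (π ⟨$⟩ʳ a)

pos : ∀ {n} → Fin n → ℕ
pos a = toℕ a

Avoids321 : ∀ {n} → Permutation′ n → Set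
Avoids321 {n} π = ¬ ∃ λ (a : Fin n) → ∃ λ (b : Fin n) → ∃ λ (c : Fin n) →
  (pos a < pos b) × (pos b < pos c) × (val π b < val π a) × (val π c < val π b)

-- A gridding assigns to each entry (by position) a cell label g a ∈ ℕ; labels must be ≥ 1.
IsStaircaseGridding : ∀ {n} → Permutation′ n → (Fin n → ℕ) → Set
IsStaircaseGridding {n} π g =
  (∀ (a : Fin n) → 1 ≤ g a)
  × (∀ (a b : Fin n) → g a ≡ g b → pos a < pos b → val π a < val π b)
  × (∀ (m : ℕ) (a b : Fin n) → g a ≡ 1 + 2 * m → g b ≡ 2 + 2 * m → pos a < pos b)
  × (∀ (m : ℕ) (a b : Fin n) → g a ≡ 2 + 2 * m → g b ≡ 3 + 2 * m → val π a < val π b)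
  × (∀ (a b : Fin n) → g a + 2 ≤ g b → (pos a < pos b) × (val π a < val π b))

cellSize : ∀ {n} → (Fin n → ℕ) → ℕ → ℕ
cellSize {n} g k = length (filter (λ a → g a ≟ k) (allFin n))

-- greedy: the vector of cell sizes (cell 1, cell 2, ...) is lexicographically maximal
-- among all staircase griddings of π: for every staircase gridding h and every k ≥ 1,
-- if h has the same cell sizes as g in cells 1,...,k-1, then cell k of h is no larger.
IsGreedy : ∀ {n} → Permutation′ n → (Fin n → ℕ) → Set
IsGreedy {n} π g = ∀ (h : Fin n → ℕ) → IsStaircaseGridding π h →
  ∀ (k : ℕ) → 1 ≤ k →
  (∀ (j : ℕ) → 1 ≤ j → j < k → cellSize h j ≡ cellSize g j) →
  cellSize h k ≤ cellSize g k

isOdd : ℕ → Bool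
isOdd zero = false
isOdd (suc zero) = true
isOdd (suc (suc k)) = isOdd k

Before : ∀ {n} → Permutation′ n → ℕ → Fin n → Fin n → Set
Before π j a b = if isOdd j then val π a < val π b else pos a < pos b

-- a is the first entry of cell k (leftmost; equivalently lowest, since cells are increasing)
IsFirstIn : ∀ {n} → (Fin n → ℕ) → ℕ → Fin n → Set
IsFirstIn {n} g k a = (g a ≡ k) × (∀ (b : Fin n) → g b ≡ k → pos a ≤ pos b)

G1 : ∀ {n} → Permutation′ n → (Fin n → ℕ) → Set
G1 {n} π g = ∀ (i : ℕ) → 1 ≤ i → ∀ (a : Fin n) → IsFirstIn g (suc i) a →
  ∀ (b : Fin n) → g b ≡ i + 2 → Before π (suc i) a b

G2 : ∀ {n} → Permutation′ n → (Fin n → ℕ) → Set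
G2 {n} π g = ∀ (i : ℕ) → 1 ≤ i → ∀ (a : Fin n) → IsFirstIn g (suc i) a →
  ∃ λ (b : Fin n) → (g b ≡ i) × Before π i a b

module Submission where

-- Cells j and j+1 of a staircase gridding are separated in one coordinate
-- (positions if j is odd, values if j is even); this is exactly the order
-- Before (j+1).  Hence an entry a of cell j and an entry b of cell j+1 with
-- Before j a b has a south-west of b, while Before j b a makes them
-- incomparable in the south-west order.
--
-- (⇒) If a greedy gridding violated (G1) or (G2) at cell i, some entry c
--   (the first entry of cell i+2, resp. of cell i+1) could be moved down to
--   cell i, giving a staircase gridding whose vector of cell sizes is
--   lexicographically larger.  (G1) is established by downward induction on i,
--   since the move for (G1) at i uses (G1) at i+1; (G2) at i uses (G1) at i.
-- (⇐) Under (G1) and (G2), every staircase gridding h dominates g pointwise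
--   (g a ≤ h a), by induction on the cell of g; pointwise domination implies
--   lexicographic maximality of the cell sizes of g, i.e. greediness.

open import Defs
open import Data.Nat using (ℕ; zero; suc; _+_; _*_; _≤_; _<_; z≤n; s≤s; _≤?_)
open import Data.Nat.Properties
open import Data.Bool using (true; false; not)
open import Data.Bool.Properties using (not-involutive)
open import Data.Fin using (Fin; toℕ; inject; fromℕ<)
open import Data.Fin.Properties
  using (toℕ-injective; toℕ-inject; toℕ-fromℕ<; any?; ¬∀⟶∃¬-smallest)
  renaming (_≟_ to _≟ᶠ_)
open import Data.Fin.Permutation using (Permutation′; _⟨$⟩ʳ_)
open import Data.List using (length; filter; allFin)
open import Data.List.Membership.Propositional using (_∈_)
open import Data.List.Membership.Propositional.Properties
  using (∈-filter⁺; ∈-filter⁻; ∈-allFin)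
open import Data.List.Relation.Binary.Sublist.Propositional using (_⊆_; ⊆-refl)
open import Data.List.Relation.Binary.Sublist.Propositional.Properties
  using (filter⁺; length-mono-≤)
open import Data.List.Relation.Binary.Sublist.Heterogeneous.Properties using (toPointwise)
open import Data.List.Relation.Binary.Pointwise using (Pointwise-≡⇒≡)
open import Data.Product using (_×_; _,_; proj₁; proj₂; ∃)
open import Data.Sum using (_⊎_; inj₁; inj₂; [_,_]′)
open import Data.Empty using (⊥; ⊥-elim)
open import Function using (id)
open import Function.Bundles using (_⇔_; mk⇔; Injection)
open import Function.Properties.Inverse using (↔⇒↣)
open import Relation.Nullary using (¬_; Dec; yes; no; ¬?)
open import Relation.Nullary.Decidable using (_×-dec_; decidable-stable)
open import Relation.Unary using (Decidable)
open import Relation.Binary using (tri<; tri≈; tri>)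
open import Relation.Binary.PropositionalEquality

successor-or-gap : ∀ {x y} → x < y → y ≡ suc x ⊎ x + 2 ≤ y
successor-or-gap {x} {suc y} (s≤s x≤y) with m≤n⇒m<n∨m≡n x≤y
... | inj₂ refl = inj₁ refl
... | inj₁ x<y = inj₂ (subst (_≤ suc y) (+-comm 2 x) (s≤s x<y))

two-below : ∀ {x i} → x ≤ i → x + 2 ≤ suc (suc i)
two-below {x} {i} x≤i = subst (x + 2 ≤_) (+-comm i 2) (+-monoˡ-≤ 2 x≤i)

-- Parity alternates, so the orders Before j and Before (j+1) compare
-- different coordinates.
isOdd-suc : ∀ j → isOdd (suc j) ≡ not (isOdd j)
isOdd-suc zero = refl
isOdd-suc (suc j) rewrite isOdd-suc j = sym (not-involutive (isOdd j))

isOdd-double : ∀ m → isOdd (2 * m) ≡ false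
isOdd-double zero = refl
isOdd-double (suc m) rewrite +-suc m (m + 0) = isOdd-double m

-- Positive labels are of the form 2m+1 or 2m+2 (the shapes used in Defs).
data Parity : ℕ → Set where
  odd  : ∀ m → Parity (1 + 2 * m)
  even : ∀ m → Parity (2 + 2 * m)

parity : ∀ j → Parity (suc j)
parity zero = odd 0
parity (suc j) with parity j
... | odd m = even m
... | even m = subst Parity (cong (λ x → suc (suc x)) (+-suc m (m + 0))) (odd (suc m))

module _ {A : Set} {P Q : A → Set} (P? : Decidable P) (Q? : Decidable Q)
         (P⇒Q : ∀ {x} → P x → Q x) where

  filter-⊆ : ∀ xs → filter P? xs ⊆ filter Q? xs
  filter-⊆ xs = filter⁺ P? Q? {as = xs} {bs = xs} (λ { refl → P⇒Q }) ⊆-refl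

  count-mono : ∀ xs → length (filter P? xs) ≤ length (filter Q? xs)
  count-mono xs = length-mono-≤ (filter-⊆ xs)

  count-saturated : ∀ xs → length (filter P? xs) ≡ length (filter Q? xs) →
                    ∀ {y} → y ∈ xs → Q y → P y
  count-saturated xs same y∈xs qy =
    proj₂ (∈-filter⁻ P? {xs = xs} (subst (_ ∈_) (sym equal) (∈-filter⁺ Q? y∈xs qy)))
    where
    equal : filter P? xs ≡ filter Q? xs
    equal = Pointwise-≡⇒≡ (toPointwise same (filter-⊆ xs))

module _ {n : ℕ} where

  cellSize-mono : ∀ {g h : Fin n → ℕ} {k} → (∀ {a} → h a ≡ k → g a ≡ k) →
                  cellSize h k ≤ cellSize g k
  cellSize-mono {g} {h} {k} h⇒g = count-mono (λ a → h a ≟ k) (λ a → g a ≟ k) h⇒g (allFin n)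

  cellSize-saturated : ∀ {g h : Fin n → ℕ} {k} → (∀ {a} → h a ≡ k → g a ≡ k) →
                       cellSize h k ≡ cellSize g k → ∀ {c} → g c ≡ k → h c ≡ k
  cellSize-saturated {g} {h} {k} h⇒g same {c} =
    count-saturated (λ a → h a ≟ k) (λ a → g a ≟ k) h⇒g (allFin n) same (∈-allFin c)

  -- If g ≤ h pointwise, the cell sizes of h are lexicographically at most those
  -- of g: as long as sizes agree below k, the two labellings agree below k, so
  -- cell k of h is contained in cell k of g.
  lex-below : ∀ {g h : Fin n → ℕ} → (∀ a → 1 ≤ g a) → (∀ a → g a ≤ h a) → ∀ k →
              (∀ j → 1 ≤ j → j < k → cellSize h j ≡ cellSize g j) →
              cellSize h k ≤ cellSize g k
  lex-below {g} {h} positive g≤h k same = cellSize-mono (shrinks (agree k ≤-refl))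
    where
    Agree : ℕ → Set
    Agree j = ∀ a → g a < j → h a ≡ g a

    -- Since g ≤ h, agreement below j puts cell j of h inside cell j of g.
    shrinks : ∀ {j} → Agree j → ∀ {b} → h b ≡ j → g b ≡ j
    shrinks agreeing {b} hb with m≤n⇒m<n∨m≡n (subst (g b ≤_) hb (g≤h b))
    ... | inj₂ gb≡j = gb≡j
    ... | inj₁ gb<j = ⊥-elim (<-irrefl (trans (sym (agreeing b gb<j)) hb) gb<j)

    -- Equal sizes then make cell j of h all of cell j of g.
    agree : ∀ j → j ≤ k → Agree j
    agree (suc j) j<k a ga<sj with m≤n⇒m<n∨m≡n (≤-pred ga<sj)
    ... | inj₁ ga<j = agree j (<⇒≤ j<k) a ga<j
    ... | inj₂ ga≡j = trans (cellSize-saturated (shrinks (agree j (<⇒≤ j<k)))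
                              (same j (subst (1 ≤_) ga≡j (positive a)) j<k) ga≡j)
                            (sym ga≡j)

  move-down-enlarges : ∀ {g h : Fin n → ℕ} {c i} →
                       h c ≡ i → (∀ b → b ≢ c → h b ≡ g b) → i < g c →
                       (∀ j → j < i → cellSize h j ≡ cellSize g j) × cellSize g i < cellSize h i
  move-down-enlarges {g} {h} {c} {i} hc moved i<gc =
    (λ j j<i → ≤-antisym (cellSize-mono (h⇒g j<i)) (cellSize-mono (g⇒h j<i)))
    , ≤∧≢⇒< (cellSize-mono g⇒h-at-i)
            (λ same → <-irrefl (sym (cellSize-saturated g⇒h-at-i same hc)) i<gc)
    where
    h⇒g : ∀ {j} → j < i → ∀ {a} → h a ≡ j → g a ≡ j
    h⇒g j<i {a} ha with a ≟ᶠ c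
    ... | yes refl = ⊥-elim (<-irrefl (trans (sym ha) hc) j<i)
    ... | no a≢c = trans (sym (moved a a≢c)) ha

    g⇒h : ∀ {j} → j < i → ∀ {a} → g a ≡ j → h a ≡ j
    g⇒h j<i {a} ga with a ≟ᶠ c
    ... | yes refl = ⊥-elim (<-asym (subst (_< i) (sym ga) j<i) i<gc)
    ... | no a≢c = trans (moved a a≢c) ga

    g⇒h-at-i : ∀ {a} → g a ≡ i → h a ≡ i
    g⇒h-at-i {a} ga with a ≟ᶠ c
    ... | yes refl = hc
    ... | no a≢c = trans (moved a a≢c) ga

labelBound : ∀ {n} (g : Fin n → ℕ) → ∃ λ B → ∀ a → g a < B
labelBound {zero} g = 0 , λ ()
labelBound {suc n} g with labelBound (λ a → g (Fin.suc a))
... | B , below = B + suc (g Fin.zero)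
                , λ { Fin.zero → m≤n+m (suc (g Fin.zero)) B
                    ; (Fin.suc a) → ≤-trans (below a) (m≤m+n B _) }

firstOf : ∀ {n} (g : Fin n → ℕ) {k b} → g b ≡ k → ∃ λ c → IsFirstIn g k c
firstOf {n} g {k} gb
  with ¬∀⟶∃¬-smallest n (λ a → g a ≢ k) (λ a → ¬? (g a ≟ k)) (λ none → none _ gb)
... | c , ¬¬gc , earlier = c , decidable-stable (g c ≟ k) ¬¬gc , least
  where
  least : ∀ b → g b ≡ k → pos c ≤ pos b
  least b gb′ = ≮⇒≥ λ b<c →
    earlier (fromℕ< b<c) (subst (λ x → g x ≡ k) (sym (inject-fromℕ< b<c)) gb′)
    where
    inject-fromℕ< : ∀ b<c → inject (fromℕ< b<c) ≡ b
    inject-fromℕ< b<c = toℕ-injective (trans (toℕ-inject (fromℕ< b<c)) (toℕ-fromℕ< b<c))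

relabel : ∀ {n} → (Fin n → ℕ) → Fin n → ℕ → Fin n → ℕ
relabel g c i a with a ≟ᶠ c
... | yes _ = i
... | no _ = g a

relabel-here : ∀ {n} (g : Fin n → ℕ) c i → relabel g c i c ≡ i
relabel-here g c i with c ≟ᶠ c
... | yes _ = refl
... | no c≢c = ⊥-elim (c≢c refl)

relabel-elsewhere : ∀ {n} (g : Fin n → ℕ) c i b → b ≢ c → relabel g c i b ≡ g b
relabel-elsewhere g c i b b≢c with b ≟ᶠ c
... | yes b≡c = ⊥-elim (b≢c b≡c)
... | no _ = refl

module _ {n : ℕ} (π : Permutation′ n) where

  SW : Fin n → Fin n → Set
  SW a b = pos a < pos b × val π a < val π b

  -- How a staircase gridding separates an entry a of cell j from an entry b of
  -- cell j+1: by position (cell j+1 to the right) if j is odd, by value (cell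
  -- j+1 above) if j is even.
  Separated : ℕ → Fin n → Fin n → Set
  Separated j = Before π (suc j)

  separated-odd : ∀ m {a b} → Separated (1 + 2 * m) a b ≡ (pos a < pos b)
  separated-odd m rewrite isOdd-double m = refl

  separated-even : ∀ m {a b} → Separated (2 + 2 * m) a b ≡ (val π a < val π b)
  separated-even m rewrite isOdd-suc (2 * m) | isOdd-double m = refl

  val-injective : ∀ {a b} → val π a ≡ val π b → a ≡ b
  val-injective e = Injection.injective (↔⇒↣ π) (toℕ-injective e)

  SW⇒Before : ∀ j {a b} → SW a b → Before π j a b
  SW⇒Before j (a<b , va<vb) with isOdd j
  ... | true = va<vb
  ... | false = a<b

  before-trans : ∀ j {a b c} → Before π j a b → Before π j b c → Before π j a c
  before-trans j with isOdd j
  ... | true = <-trans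
  ... | false = <-trans

  before-asym : ∀ j {a b} → Before π j a b → Before π j b a → ⊥
  before-asym j with isOdd j
  ... | true = <-asym
  ... | false = <-asym

  before-total : ∀ j {a b} → a ≢ b → ¬ Before π j a b → Before π j b a
  before-total j {a} {b} a≢b ¬ab with isOdd j
  ... | true = ≤∧≢⇒< (≮⇒≥ ¬ab) (λ e → a≢b (sym (val-injective e)))
  ... | false = ≤∧≢⇒< (≮⇒≥ ¬ab) (λ e → a≢b (sym (toℕ-injective e)))

  before? : ∀ j a b → Dec (Before π j a b)
  before? j a b with isOdd j
  ... | true = val π a <? val π b
  ... | false = pos a <? pos b

  before-separated⇒SW : ∀ j {a b} → Before π j a b → Separated j a b → SW a b
  before-separated⇒SW j ab sep with isOdd j | isOdd (suc j) | isOdd-suc j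
  ... | true | .false | refl = sep , ab
  ... | false | .true | refl = ab , sep

  Constraint : ℕ → ℕ → Fin n → Fin n → Set
  Constraint x y a b = (x ≡ y → pos a < pos b → val π a < val π b)
                     × (y ≡ suc x → Separated x a b)
                     × (x + 2 ≤ y → SW a b)

  sw-constraint : ∀ {x y a b} → SW a b → Constraint x y a b
  sw-constraint {x} sw = (λ _ _ → proj₂ sw) , (λ _ → SW⇒Before (suc x) sw) , (λ _ → sw)

  below-constraint : ∀ {x y a b} → y < x → Constraint x y a b
  below-constraint {x} y<x =
    (λ x≡y → ⊥-elim (<-irrefl (sym x≡y) y<x))
    , (λ y≡1+x → ⊥-elim (<-asym y<x (subst (x <_) (sym y≡1+x) (n<1+n x))))
    , (λ gap → ⊥-elim (<-asym y<x (<-≤-trans (m<m+n x (s≤s z≤n)) gap)))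

  diagonal-constraint : ∀ {x a} → Constraint x x a a
  diagonal-constraint {x} =
    (λ _ a<a → ⊥-elim (<-irrefl refl a<a))
    , (λ x≡1+x → ⊥-elim (1+n≢n (sym x≡1+x)))
    , (λ gap → ⊥-elim (<-irrefl refl (<-≤-trans (m<m+n x (s≤s z≤n)) gap)))

  module _ {g : Fin n → ℕ} where

    -- Consecutive cells of a staircase gridding are separated (Defs states this
    -- separately for odd and even labels).
    separated : IsStaircaseGridding π g → ∀ {a b j} → g a ≡ j → g b ≡ suc j → Separated j a b
    separated (positive , _) {a} {j = zero} ga _ with subst (1 ≤_) ga (positive a)
    ... | ()
    separated (_ , _ , right , above , _) {a} {b} {suc j} ga gb with parity j
    ... | odd m = subst id (sym (separated-odd m)) (right m a b ga gb)
    ... | even m = subst id (sym (separated-even m)) (above m a b ga gb)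

    far-apart : IsStaircaseGridding π g → ∀ {a b} → g a + 2 ≤ g b → SW a b
    far-apart (_ , _ , _ , _ , far) = far _ _

    -- A staircase gridding is exactly a positive labelling meeting all constraints.
    constraints : IsStaircaseGridding π g → ∀ a b → Constraint (g a) (g b) a b
    constraints sg@(_ , increasing , _) a b =
      increasing a b , separated sg refl , far-apart sg

    fromConstraints : (∀ a → 1 ≤ g a) → (∀ a b → Constraint (g a) (g b) a b) →
                      IsStaircaseGridding π g
    fromConstraints positive constraint =
      positive
      , (λ a b → proj₁ (constraint a b))
      , (λ m a b ga gb → subst id (separated-odd m) (separated-at ga gb))
      , (λ m a b ga gb → subst id (separated-even m) (separated-at ga gb))
      , (λ a b → proj₂ (proj₂ (constraint a b)))
      where
      separated-at : ∀ {a b x} → g a ≡ x → g b ≡ suc x → Separated x a b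
      separated-at {a} {b} refl gb = proj₁ (proj₂ (constraint a b)) gb

    first-SW : IsStaircaseGridding π g → ∀ {k c b} → IsFirstIn g k c → g b ≡ k → b ≢ c →
               SW c b
    first-SW (_ , increasing , _) {c = c} {b} (gc , least) gb b≢c =
      c<b , increasing c b (trans gc (sym gb)) c<b
      where
      c<b : pos c < pos b
      c<b = ≤∧≢⇒< (least b gb) (λ e → b≢c (sym (toℕ-injective e)))

    first-before : IsStaircaseGridding π g → ∀ j {k c b x} → IsFirstIn g k c → g b ≡ k →
                   Before π j b x → Before π j c x
    first-before sg j {c = c} {b} fc gb bx with b ≟ᶠ c
    ... | yes refl = bx
    ... | no b≢c = before-trans j (SW⇒Before j (first-SW sg fc gb b≢c)) bx

    before-first : IsStaircaseGridding π g → ∀ j {k c b x} → IsFirstIn g k c → g b ≡ k →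
                   Before π j x c → Before π j x b
    before-first sg j {c = c} {b} fc gb xc with b ≟ᶠ c
    ... | yes refl = xc
    ... | no b≢c = before-trans j xc (SW⇒Before j (first-SW sg fc gb b≢c))

    FirstPrecedesNext : ℕ → Set
    FirstPrecedesNext k = ∀ a → IsFirstIn g k a → ∀ b → g b ≡ suc k → Before π k a b

    first-SW-above : IsStaircaseGridding π g → ∀ {k c} → FirstPrecedesNext k → IsFirstIn g k c →
                     ∀ b → b ≢ c → k ≤ g b → SW c b
    first-SW-above sg {k} {c} next fc b b≢c k≤gb with m≤n⇒m<n∨m≡n k≤gb
    ... | inj₂ k≡gb = first-SW sg fc (sym k≡gb) b≢c
    ... | inj₁ k<gb with successor-or-gap k<gb
    ...   | inj₁ gb≡ = before-separated⇒SW k (next c fc b gb≡) (separated sg (proj₁ fc) gb≡)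
    ...   | inj₂ gap = far-apart sg (subst (λ x → x + 2 ≤ g b) (sym (proj₁ fc)) gap)

  sw-monotone : ∀ {h} → IsStaircaseGridding π h → ∀ {u v} → SW u v → h u ≤ h v
  sw-monotone {h} sh {u} {v} sw with h u ≤? h v
  ... | yes hu≤hv = hu≤hv
  ... | no hu≰hv with successor-or-gap (≰⇒> hu≰hv)
  ...   | inj₁ hu≡ =
    ⊥-elim (before-asym (suc (h v)) (separated sh refl hu≡) (SW⇒Before (suc (h v)) sw))
  ...   | inj₂ gap = ⊥-elim (<-asym (proj₁ sw) (proj₁ (far-apart sh gap)))

  incomparable-adjacent : ∀ {h} → IsStaircaseGridding π h → ∀ {a b} → a ≢ b →
                          ¬ SW a b → ¬ SW b a → h b ≡ suc (h a) ⊎ h a ≡ suc (h b)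
  incomparable-adjacent {h} sh@(_ , increasing , _) {a} {b} a≢b ¬ab ¬ba
    with <-cmp (h a) (h b)
  ... | tri< ha<hb _ _ =
    [ inj₁ , (λ gap → ⊥-elim (¬ab (far-apart sh gap))) ]′ (successor-or-gap ha<hb)
  ... | tri> _ _ hb<ha =
    [ inj₂ , (λ gap → ⊥-elim (¬ba (far-apart sh gap))) ]′ (successor-or-gap hb<ha)
  ... | tri≈ _ same _ with <-cmp (pos a) (pos b)
  ...   | tri< a<b _ _ = ⊥-elim (¬ab (a<b , increasing a b same a<b))
  ...   | tri≈ _ a≡b _ = ⊥-elim (a≢b (toℕ-injective a≡b))
  ...   | tri> _ _ b<a = ⊥-elim (¬ba (b<a , increasing b a (sym same) b<a))

  Movable : (Fin n → ℕ) → Fin n → ℕ → Set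
  Movable g c i = ∀ b → b ≢ c → (g b ≤ i → SW b c)
                               × (g b ≡ suc i → Separated i c b)
                               × (i + 2 ≤ g b → SW c b)

  moved-gridding : ∀ {g c i} → IsStaircaseGridding π g → 1 ≤ i → Movable g c i →
                   IsStaircaseGridding π (relabel g c i)
  moved-gridding {g} {c} {i} sg 1≤i movable = fromConstraints positive constraint
    where
    positive : ∀ a → 1 ≤ relabel g c i a
    positive a with a ≟ᶠ c
    ... | yes _ = 1≤i
    ... | no _ = proj₁ sg a

    upward : ∀ b → b ≢ c → Constraint i (g b) c b
    upward b b≢c with movable b b≢c
    ... | low , next , gap-SW =
      (λ i≡gb c<b → ⊥-elim (<-asym c<b (proj₁ (low (≤-reflexive (sym i≡gb)))))) , next , gap-SW

    downward : ∀ a → a ≢ c → Constraint (g a) i a c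
    downward a a≢c with g a ≤? i
    ... | yes ga≤i = sw-constraint (proj₁ (movable a a≢c) ga≤i)
    ... | no ga≰i = below-constraint (≰⇒> ga≰i)

    constraint : ∀ a b → Constraint (relabel g c i a) (relabel g c i b) a b
    constraint a b with a ≟ᶠ c | b ≟ᶠ c
    ... | yes refl | yes refl = diagonal-constraint
    ... | yes refl | no b≢c = upward b b≢c
    ... | no a≢c | yes refl = downward a a≢c
    ... | no _ | no _ = constraints sg a b

  module Greedy {g : Fin n → ℕ} (sg : IsStaircaseGridding π g) (greedy : IsGreedy π g) where

    immovable : ∀ {c i} → 1 ≤ i → i < g c → ¬ Movable g c i
    immovable {c} {i} 1≤i i<gc movable =
      <⇒≱ (proj₂ enlarged)
          (greedy h (moved-gridding sg 1≤i movable) i 1≤i (λ j _ → proj₁ enlarged j))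
      where
      h : Fin n → ℕ
      h = relabel g c i

      enlarged : (∀ j → j < i → cellSize h j ≡ cellSize g j) × cellSize g i < cellSize h i
      enlarged = move-down-enlarges (relabel-here g c i) (relabel-elsewhere g c i) i<gc

    -- (G1) at cell i+1 follows from (G1) at cell i+2: otherwise the first entry
    -- of cell i+2 can be moved down to cell i.
    precedes-down : ∀ {i} → 1 ≤ i → FirstPrecedesNext (suc (suc i)) → FirstPrecedesNext (suc i)
    precedes-down {i} 1≤i next a fa b₀ gb₀ with before? (suc i) a b₀
    ... | yes a<b₀ = a<b₀
    ... | no ¬a<b₀ with firstOf g gb₀
    ...   | c , fc = ⊥-elim (immovable 1≤i i<gc movable)
      where
      i<gc : i < g c
      i<gc = subst (i <_) (sym (proj₁ fc)) (m<n⇒m<1+n (n<1+n i))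

      a≢b₀ : a ≢ b₀
      a≢b₀ refl = 1+n≢n (trans (sym gb₀) (proj₁ fa))

      c-before-a : Before π (suc i) c a
      c-before-a = first-before sg (suc i) fc gb₀ (before-total (suc i) a≢b₀ ¬a<b₀)

      movable : Movable g c i
      movable b b≢c =
        (λ gb≤i → far-apart sg (subst (g b + 2 ≤_) (sym (proj₁ fc)) (two-below gb≤i)))
        , (λ gb≡ → before-first sg (suc i) fa gb≡ c-before-a)
        , (λ gap → first-SW-above sg next fc b b≢c (subst (_≤ g b) (+-comm i 2) gap))

    -- Above all labels (G1) holds vacuously; descend with precedes-down.
    precedes : ∀ i → 1 ≤ i → FirstPrecedesNext (suc i)
    precedes i 1≤i with labelBound g
    ... | B , bound = descend B i 1≤i (λ a → ≤-trans (bound a) (m≤m+n B (suc i)))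
      where
      descend : ∀ d i → 1 ≤ i → (∀ a → g a < d + suc i) → FirstPrecedesNext (suc i)
      descend zero i _ below a fa = ⊥-elim (<-irrefl (proj₁ fa) (below a))
      descend (suc d) i 1≤i below = precedes-down 1≤i
        (descend d (suc i) (s≤s z≤n) (λ a → subst (g a <_) (sym (+-suc d (suc i))) (below a)))

    g1 : G1 π g
    g1 i 1≤i a fa b gb = precedes i 1≤i a fa b (trans gb (+-comm i 2))

    -- (G2) at i: otherwise the first entry of cell i+1 can be moved down to cell i.
    g2 : G2 π g
    g2 i 1≤i a fa with any? (λ b → (g b ≟ i) ×-dec before? i a b)
    ... | yes found = found
    ... | no none = ⊥-elim (immovable 1≤i (subst (i <_) (sym (proj₁ fa)) (n<1+n i)) movable)
      where
      above : ∀ b → b ≢ a → suc i ≤ g b → SW a b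
      above = first-SW-above sg (precedes i 1≤i) fa

      movable : Movable g a i
      movable b b≢a =
        below
        , (λ gb≡ → SW⇒Before (suc i) (above b b≢a (≤-reflexive (sym gb≡))))
        , (λ gap → above b b≢a (≤-trans (n≤1+n (suc i)) (subst (_≤ g b) (+-comm i 2) gap)))
        where
        below : g b ≤ i → SW b a
        below gb≤i with m≤n⇒m<n∨m≡n gb≤i
        ... | inj₁ gb<i = far-apart sg (subst (g b + 2 ≤_) (sym (proj₁ fa)) (≤-pred (two-below gb<i)))
        ... | inj₂ gb≡i = before-separated⇒SW i
                            (before-total i (λ a≡b → b≢a (sym a≡b))
                                            (λ ab → none (b , gb≡i , ab)))
                            (separated sg gb≡i (proj₁ fa))

  module Dominance {g : Fin n → ℕ} (sg : IsStaircaseGridding π g) (g1 : G1 π g) (g2 : G2 π g)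
                   {h : Fin n → ℕ} (sh : IsStaircaseGridding π h) where

    Dominated : ℕ → Set
    Dominated m = ∀ x → g x ≡ m → m ≤ h x

    -- By monotonicity it suffices to dominate the first entry of a cell.
    dominated-from-first : ∀ {k f} → IsFirstIn g k f → k ≤ h f → Dominated k
    dominated-from-first {f = f} ff k≤hf x gx with x ≟ᶠ f
    ... | yes refl = k≤hf
    ... | no x≢f = ≤-trans k≤hf (sw-monotone sh (first-SW sg ff gx x≢f))

    -- (G1) prevents an entry of cell i+2 of g from lying in cell i of h.
    no-drop : ∀ {i y f} → 1 ≤ i → Dominated (suc i) → g y ≡ suc i → g f ≡ suc (suc i) →
              h f ≡ i → ⊥
    no-drop {i} {f = f} 1≤i dom gy gf hf with firstOf g gy
    ... | f′ , ff′ =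
      1+n≰n (≤-trans (dom f′ (proj₁ ff′)) (subst (h f′ ≤_) hf (sw-monotone sh sw)))
      where
      sw : SW f′ f
      sw = before-separated⇒SW (suc i) (g1 i 1≤i f′ ff′ f (trans gf (+-comm 2 i)))
                               (separated sg (proj₁ ff′) gf)

    -- The first entry f of cell m+1 is not in a cell ≤ m of h: by (G2) it is
    -- incomparable with some y of cell m, so h puts f and y in adjacent cells.
    first-dominated : ∀ {m f} → 1 ≤ m → Dominated m → IsFirstIn g (suc m) f → suc m ≤ h f
    first-dominated {m} {f} 1≤m dom ff with g2 m 1≤m f ff
    ... | y , gy , f-before-y =
      [ (λ hf≡ → subst (suc m ≤_) (sym hf≡) (s≤s (dom y gy))) , y-above ]′
        (incomparable-adjacent sh y≢f ¬y-SW-f ¬f-SW-y)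
      where
      y-separated-f : Separated m y f
      y-separated-f = separated sg gy (proj₁ ff)

      ¬f-SW-y : ¬ SW f y
      ¬f-SW-y sw = before-asym (suc m) y-separated-f (SW⇒Before (suc m) sw)

      ¬y-SW-f : ¬ SW y f
      ¬y-SW-f sw = before-asym m f-before-y (SW⇒Before m sw)

      y≢f : y ≢ f
      y≢f refl = 1+n≢n (trans (sym (proj₁ ff)) gy)

      y-above : h y ≡ suc (h f) → suc m ≤ h f
      y-above hy≡ with <-cmp (h f) m
      ... | tri> _ _ m<hf = m<hf
      ... | tri≈ _ hf≡m _ = ⊥-elim (before-asym (suc m) y-separated-f
                              (subst (λ j → Separated j f y) hf≡m (separated sh refl hy≡)))
      ... | tri< hf<m _ _ = ⊥-elim (no-drop (proj₁ sh f) (subst Dominated m≡ dom)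
                              (trans gy m≡) (trans (proj₁ ff) (cong suc m≡)) refl)
        where
        m≡ : m ≡ suc (h f)
        m≡ = ≤-antisym (subst (m ≤_) hy≡ (dom y gy)) hf<m

    -- Induction on the cells of g; cell 1 is dominated since labels are positive.
    dominated-step : ∀ {m} → 1 ≤ m → Dominated m → Dominated (suc m)
    dominated-step 1≤m dom x gx with firstOf g gx
    ... | f , ff = dominated-from-first ff (first-dominated 1≤m dom ff) x gx

    dominated : ∀ m → Dominated m
    dominated zero _ _ = z≤n
    dominated (suc zero) x _ = proj₁ sh x
    dominated (suc (suc m)) = dominated-step (s≤s z≤n) (dominated (suc m))

    dominates : ∀ x → g x ≤ h x
    dominates x = dominated (g x) x refl

proposition2p1 : ∀ (n : ℕ) (π : Permutation′ n) → Avoids321 π →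
    (g : Fin n → ℕ) → IsStaircaseGridding π g →
    IsGreedy π g ⇔ (G1 π g × G2 π g)
proposition2p1 n π _ g sg = mk⇔ greedy⇒G1G2 G1G2⇒greedy
  where
  greedy⇒G1G2 : IsGreedy π g → G1 π g × G2 π g
  greedy⇒G1G2 greedy = Greedy.g1 π sg greedy , Greedy.g2 π sg greedy

  G1G2⇒greedy : G1 π g × G2 π g → IsGreedy π g
  G1G2⇒greedy (g1 , g2) h sh k _ = lex-below (proj₁ sg) (Dominance.dominates π sg g1 g2 sh) k
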